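{- Every axiomatic extension $\mathcal L$ of the Glivenko logic of classical logic with respect to $\mathcal{FL}_w$ is passively structurally complete.
   Context: $\mathcal{FL}_w$ is the Full Lambek calculus with weakening, whose equivalent algebraic semantics is the variety of $\mathsf{FL}_w$-algebras: $(A,\vee,\wedge,\cdot,\backslash,/,1,0)$ with $(A,\vee,\wedge)$ a lattice, $(A,\cdot,1)$ a monoid, $x\cdot y\le z$ iff $y\le x\backslash z$ iff $x\le z/y$, and $0\le x\le 1$. Write $\neg x = x\backslash 0$ and $\sim x = 0/x$. Two logics $\mathcal L_1,\mathcal L_2$ are Glivenko equivalent if for every formula $\varphi$, $\vdash_{\mathcal L_1}\neg\varphi$ iff $\vdash_{\mathcal L_2}\neg\varphi$. The Glivenko logic of classical logic with respect to $\mathcal{FL}_w$ is the smallest axiomatic extension of $\mathcal{FL}_w$ that is Glivenko equivalent to classical logic; it is axiomatized relative to $\mathcal{FL}_w$ by $\{\neg\sim\varphi : \varphi \text{ a classical tautology}\}$. A rule $\Sigma\Rightarrow\gamma$ (finite $\Sigma$) is admissible if every substitution making all formulas of $\Sigma$ theorems makes $\gamma$ a theorem, passive if no substitution makes all of $\Sigma$ theorems, derivable if $\Sigma\vdash_{\mathcal L}\gamma$. $\mathcal L$ is passively structurally complete if every passive admissible rule is derivable. -}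

module Defs where

open import Data.Nat using (ℕ)
open import Data.Bool using (Bool; true; false; not) renaming (_∨_ to _∨ᵇ_; _∧_ to _∧ᵇ_)
open import Data.List using (List)
open import Data.List.Membership.Propositional using (_∈_)
open import Data.Product using (Σ; _×_; ∃)
open import Relation.Binary.PropositionalEquality using (_≡_)
open import Relation.Nullary using (¬_)

infixr 5 _∨ᶠ_
infixr 6 _∧ᶠ_
infixr 7 _·ᶠ_
infixr 8 _⇒ᶠ_ _⇐ᶠ_

data Fm : Set where
  var   : ℕ → Fm
  _∨ᶠ_  : Fm → Fm → Fm
  _∧ᶠ_  : Fm → Fm → Fm
  _·ᶠ_  : Fm → Fm → Fm
  _⇒ᶠ_  : Fm → Fm → Fm
  _⇐ᶠ_  : Fm → Fm → Fm
  𝟏     : Fm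
  𝟎     : Fm

¬ᶠ_ : Fm → Fm
¬ᶠ φ = φ ⇒ᶠ 𝟎

∼ᶠ_ : Fm → Fm
∼ᶠ φ = 𝟎 ⇐ᶠ φ

Subst : Set
Subst = ℕ → Fm

_[_] : Fm → Subst → Fm
var n    [ s ] = s n
(φ ∨ᶠ ψ) [ s ] = (φ [ s ]) ∨ᶠ (ψ [ s ])
(φ ∧ᶠ ψ) [ s ] = (φ [ s ]) ∧ᶠ (ψ [ s ])
(φ ·ᶠ ψ) [ s ] = (φ [ s ]) ·ᶠ (ψ [ s ])
(φ ⇒ᶠ ψ) [ s ] = (φ [ s ]) ⇒ᶠ (ψ [ s ])
(φ ⇐ᶠ ψ) [ s ] = (φ [ s ]) ⇐ᶠ (ψ [ s ])
𝟏 [ s ] = 𝟏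
𝟎 [ s ] = 𝟎

record FLwAlgebra : Set₁ where
  infix 4 _≤_
  field
    Carrier : Set
    _≤_     : Carrier → Carrier → Set
    _∨_ _∧_ _·_ _⇒_ _⇐_ : Carrier → Carrier → Carrier
    one zero : Carrier
    ≤-refl    : ∀ {x} → x ≤ x
    ≤-trans   : ∀ {x y z} → x ≤ y → y ≤ z → x ≤ z
    ≤-antisym : ∀ {x y} → x ≤ y → y ≤ x → x ≡ y
    ∨-upperˡ : ∀ x y → x ≤ x ∨ y
    ∨-upperʳ : ∀ x y → y ≤ x ∨ y
    ∨-least  : ∀ {x y z} → x ≤ z → y ≤ z → x ∨ y ≤ z
    ∧-lowerˡ : ∀ x y → x ∧ y ≤ x
    ∧-lowerʳ : ∀ x y → x ∧ y ≤ y
    ∧-greatest : ∀ {x y z} → z ≤ x → z ≤ y → z ≤ x ∧ y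
    ·-assoc    : ∀ x y z → (x · y) · z ≡ x · (y · z)
    ·-identityˡ : ∀ x → one · x ≡ x
    ·-identityʳ : ∀ x → x · one ≡ x
    res-\ : ∀ {x y z} → x · y ≤ z → y ≤ x ⇒ z
    \-res : ∀ {x y z} → y ≤ x ⇒ z → x · y ≤ z
    res-/ : ∀ {x y z} → x · y ≤ z → x ≤ z ⇐ y
    /-res : ∀ {x y z} → x ≤ z ⇐ y → x · y ≤ z
    zero-least : ∀ x → zero ≤ x
    one-greatest : ∀ x → x ≤ one

  ⟦_⟧ : Fm → (ℕ → Carrier) → Carrier
  ⟦ var n ⟧ h = h n
  ⟦ φ ∨ᶠ ψ ⟧ h = ⟦ φ ⟧ h ∨ ⟦ ψ ⟧ h
  ⟦ φ ∧ᶠ ψ ⟧ h = ⟦ φ ⟧ h ∧ ⟦ ψ ⟧ h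
  ⟦ φ ·ᶠ ψ ⟧ h = ⟦ φ ⟧ h · ⟦ ψ ⟧ h
  ⟦ φ ⇒ᶠ ψ ⟧ h = ⟦ φ ⟧ h ⇒ ⟦ ψ ⟧ h
  ⟦ φ ⇐ᶠ ψ ⟧ h = ⟦ φ ⟧ h ⇐ ⟦ ψ ⟧ h
  ⟦ 𝟏 ⟧ h = one
  ⟦ 𝟎 ⟧ h = zero

-- Axiomatic extensions of FL_w, presented by a set of axioms, and their
-- consequence relation via the equivalent algebraic semantics
-- (translation φ ↦ 1 ≤ φ).

Axioms : Set₁
Axioms = Fm → Set

Models : Axioms → FLwAlgebra → Set
Models Ax A = ∀ φ → Ax φ → ∀ h → one ≤ ⟦ φ ⟧ h
  where open FLwAlgebra A

_⊢[_]_ : List Fm → Axioms → Fm → Set₁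
Γ ⊢[ Ax ] γ = ∀ (A : FLwAlgebra) → Models Ax A → ∀ h →
  (∀ σ → σ ∈ Γ → FLwAlgebra._≤_ A (FLwAlgebra.one A) (FLwAlgebra.⟦_⟧ A σ h)) →
  FLwAlgebra._≤_ A (FLwAlgebra.one A) (FLwAlgebra.⟦_⟧ A γ h)

Theorem : Axioms → Fm → Set₁
Theorem Ax φ = ∀ (A : FLwAlgebra) → Models Ax A → ∀ h →
  FLwAlgebra._≤_ A (FLwAlgebra.one A) (FLwAlgebra.⟦_⟧ A φ h)

evalB : (ℕ → Bool) → Fm → Bool
evalB v (var n) = v n
evalB v (φ ∨ᶠ ψ) = evalB v φ ∨ᵇ evalB v ψ
evalB v (φ ∧ᶠ ψ) = evalB v φ ∧ᵇ evalB v ψ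
evalB v (φ ·ᶠ ψ) = evalB v φ ∧ᵇ evalB v ψ
evalB v (φ ⇒ᶠ ψ) = not (evalB v φ) ∨ᵇ evalB v ψ
evalB v (φ ⇐ᶠ ψ) = not (evalB v ψ) ∨ᵇ evalB v φ
evalB v 𝟏 = true
evalB v 𝟎 = false

ClassicalTautology : Fm → Set
ClassicalTautology φ = ∀ (v : ℕ → Bool) → evalB v φ ≡ true

GlivenkoAxiom : Axioms
GlivenkoAxiom χ = Σ Fm (λ φ → ClassicalTautology φ × (χ ≡ ¬ᶠ (∼ᶠ φ)))

Extends : Axioms → Axioms → Set₁
Extends Ax Bx = ∀ φ → Theorem Bx φ → Theorem Ax φ

Admissible : Axioms → List Fm → Fm → Set₁
Admissible Ax Γ γ = ∀ (s : Subst) → (∀ σ → σ ∈ Γ → Theorem Ax (σ [ s ])) → Theorem Ax (γ [ s ])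

Passive : Axioms → List Fm → Set₁
Passive Ax Γ = ¬ (Σ Subst (λ s → ∀ σ → σ ∈ Γ → Theorem Ax (σ [ s ])))

Derivable : Axioms → List Fm → Fm → Set₁
Derivable Ax Γ γ = Γ ⊢[ Ax ] γ

PassivelyStructurallyComplete : Axioms → Set₁
PassivelyStructurallyComplete Ax =
  ∀ (Γ : List Fm) (γ : Fm) → Passive Ax Γ → Admissible Ax Γ γ → Derivable Ax Γ γ

{-# OPTIONS --safe #-}
-- Substituting the constants 0 and 1 for the variables according to a
-- Boolean valuation v makes every formula evaluate, in every FL_w-algebra,
-- to its two-valued truth value under v.  So if Γ is passive, no v satisfies
-- ⋀Γ, i.e. ¬⋀Γ is a classical tautology and ¬∼¬⋀Γ is a theorem of L.  In an
-- FL_w-algebra, however, 1 ≤ d gives ¬d = 0, hence ∼¬d = 1 and ¬∼¬d = 0.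
module Submission where

open import Defs
open import Data.Nat using (ℕ)
open import Data.Bool using (Bool; true; false; not) renaming (_∨_ to _∨ᵇ_; _∧_ to _∧ᵇ_)
open import Data.Bool.Properties using (∧-conicalˡ; ∧-conicalʳ)
open import Data.Empty using (⊥-elim)
open import Data.List using (List; []; _∷_; foldr)
open import Data.List.Membership.Propositional using (_∈_)
open import Data.List.Relation.Unary.Any using (here; there)
open import Data.Product using (_,_)
open import Relation.Binary.PropositionalEquality using (_≡_; refl; sym; trans; cong; cong₂)

module FLwProperties (A : FLwAlgebra) where
  open FLwAlgebra A

  ¬_ ∼_ : Carrier → Carrier
  ¬ x = x ⇒ zero
  ∼ x = zero ⇐ x

  ≤-reflexive : ∀ {x y} → x ≡ y → x ≤ y
  ≤-reflexive refl = ≤-refl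

  one≤⇒≡one : ∀ {x} → one ≤ x → x ≡ one
  one≤⇒≡one = ≤-antisym (one-greatest _)

  ≤zero⇒≡zero : ∀ {x} → x ≤ zero → x ≡ zero
  ≤zero⇒≡zero p = ≤-antisym p (zero-least _)

  ·-monoˡ-≤ : ∀ {x y} z → x ≤ y → x · z ≤ y · z
  ·-monoˡ-≤ z x≤y = /-res (≤-trans x≤y (res-/ ≤-refl))

  one≤⇒residual≤ : ∀ {x z} → one ≤ x → x ⇒ z ≤ z
  one≤⇒residual≤ {x} {z} one≤x =
    ≤-trans (≤-reflexive (sym (·-identityˡ (x ⇒ z))))
            (≤-trans (·-monoˡ-≤ (x ⇒ z) one≤x) (\-res ≤-refl))

  ≤⇒one≤⇐ : ∀ {x z} → x ≤ z → one ≤ z ⇐ x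
  ≤⇒one≤⇐ {x} x≤z = res-/ (≤-trans (≤-reflexive (·-identityˡ x)) x≤z)

  one≤zero-from-¬∼¬ : ∀ {d} → one ≤ d → one ≤ ¬ ∼ ¬ d → one ≤ zero
  one≤zero-from-¬∼¬ one≤d one≤¬∼¬d =
    ≤-trans one≤¬∼¬d (one≤⇒residual≤ (≤⇒one≤⇐ (one≤⇒residual≤ one≤d)))

  zero∨x≡x : ∀ x → zero ∨ x ≡ x
  zero∨x≡x x = ≤-antisym (∨-least (zero-least x) ≤-refl) (∨-upperʳ zero x)

  one∨x≡one : ∀ x → one ∨ x ≡ one
  one∨x≡one x = one≤⇒≡one (∨-upperˡ one x)

  one∧x≡x : ∀ x → one ∧ x ≡ x
  one∧x≡x x = ≤-antisym (∧-lowerʳ one x) (∧-greatest (one-greatest x) ≤-refl)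

  zero∧x≡zero : ∀ x → zero ∧ x ≡ zero
  zero∧x≡zero x = ≤zero⇒≡zero (∧-lowerˡ zero x)

  zero·x≡zero : ∀ x → zero · x ≡ zero
  zero·x≡zero x = ≤zero⇒≡zero (/-res (zero-least (zero ⇐ x)))

  one⇒x≡x : ∀ x → one ⇒ x ≡ x
  one⇒x≡x x = ≤-antisym (one≤⇒residual≤ ≤-refl) (res-\ (≤-reflexive (·-identityˡ x)))

  zero⇒x≡one : ∀ x → zero ⇒ x ≡ one
  zero⇒x≡one x = one≤⇒≡one (res-\ (≤-trans (≤-reflexive (zero·x≡zero one)) (zero-least x)))

  x⇐one≡x : ∀ x → x ⇐ one ≡ x
  x⇐one≡x x = ≤-antisym (≤-trans (≤-reflexive (sym (·-identityʳ _))) (/-res ≤-refl))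
                        (res-/ (≤-reflexive (·-identityʳ x)))

  x⇐zero≡one : ∀ x → x ⇐ zero ≡ one
  x⇐zero≡one x = one≤⇒≡one (res-/ (≤-trans (≤-reflexive (·-identityˡ zero)) (zero-least x)))

  fromBool : Bool → Carrier
  fromBool true  = one
  fromBool false = zero

  fromBool-∨ : ∀ a b → fromBool a ∨ fromBool b ≡ fromBool (a ∨ᵇ b)
  fromBool-∨ true  b = one∨x≡one (fromBool b)
  fromBool-∨ false b = zero∨x≡x (fromBool b)

  fromBool-∧ : ∀ a b → fromBool a ∧ fromBool b ≡ fromBool (a ∧ᵇ b)
  fromBool-∧ true  b = one∧x≡x (fromBool b)
  fromBool-∧ false b = zero∧x≡zero (fromBool b)

  fromBool-· : ∀ a b → fromBool a · fromBool b ≡ fromBool (a ∧ᵇ b)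
  fromBool-· true  b = ·-identityˡ (fromBool b)
  fromBool-· false b = zero·x≡zero (fromBool b)

  fromBool-⇒ : ∀ a b → fromBool a ⇒ fromBool b ≡ fromBool (not a ∨ᵇ b)
  fromBool-⇒ true  b = one⇒x≡x (fromBool b)
  fromBool-⇒ false b = zero⇒x≡one (fromBool b)

  fromBool-⇐ : ∀ a b → fromBool a ⇐ fromBool b ≡ fromBool (not b ∨ᵇ a)
  fromBool-⇐ a true  = x⇐one≡x (fromBool a)
  fromBool-⇐ a false = x⇐zero≡one (fromBool a)

⌜_⌝ : Bool → Fm
⌜ true ⌝  = 𝟏
⌜ false ⌝ = 𝟎

boolSubst : (ℕ → Bool) → Subst
boolSubst v n = ⌜ v n ⌝

⋀ : List Fm → Fm
⋀ = foldr _∧ᶠ_ 𝟏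

evalB-⋀ : ∀ v {Γ σ} → evalB v (⋀ Γ) ≡ true → σ ∈ Γ → evalB v σ ≡ true
evalB-⋀ v {φ ∷ Γ} ⋀Γ-true (here refl)  = ∧-conicalˡ (evalB v φ) _ ⋀Γ-true
evalB-⋀ v {φ ∷ Γ} ⋀Γ-true (there σ∈Γ) = evalB-⋀ v (∧-conicalʳ _ (evalB v (⋀ Γ)) ⋀Γ-true) σ∈Γ

module _ (A : FLwAlgebra) (h : ℕ → FLwAlgebra.Carrier A) where
  open FLwAlgebra A
  open FLwProperties A

  ⟦⌜⌝⟧ : ∀ b → ⟦ ⌜ b ⌝ ⟧ h ≡ fromBool b
  ⟦⌜⌝⟧ true  = refl
  ⟦⌜⌝⟧ false = refl

  ⟦boolSubst⟧ : ∀ v φ → ⟦ φ [ boolSubst v ] ⟧ h ≡ fromBool (evalB v φ)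
  ⟦boolSubst⟧ v = go
    where
    go : ∀ φ → ⟦ φ [ boolSubst v ] ⟧ h ≡ fromBool (evalB v φ)
    go (var n)  = ⟦⌜⌝⟧ (v n)
    go (φ ∨ᶠ ψ) = trans (cong₂ _∨_ (go φ) (go ψ)) (fromBool-∨ (evalB v φ) (evalB v ψ))
    go (φ ∧ᶠ ψ) = trans (cong₂ _∧_ (go φ) (go ψ)) (fromBool-∧ (evalB v φ) (evalB v ψ))
    go (φ ·ᶠ ψ) = trans (cong₂ _·_ (go φ) (go ψ)) (fromBool-· (evalB v φ) (evalB v ψ))
    go (φ ⇒ᶠ ψ) = trans (cong₂ _⇒_ (go φ) (go ψ)) (fromBool-⇒ (evalB v φ) (evalB v ψ))
    go (φ ⇐ᶠ ψ) = trans (cong₂ _⇐_ (go φ) (go ψ)) (fromBool-⇐ (evalB v φ) (evalB v ψ))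
    go 𝟏 = refl
    go 𝟎 = refl

  one≤⟦⋀⟧ : ∀ Γ → (∀ σ → σ ∈ Γ → one ≤ ⟦ σ ⟧ h) → one ≤ ⟦ ⋀ Γ ⟧ h
  one≤⟦⋀⟧ []      _  = ≤-refl
  one≤⟦⋀⟧ (φ ∷ Γ) ⊨Γ = ∧-greatest (⊨Γ φ (here refl)) (one≤⟦⋀⟧ Γ (λ σ σ∈Γ → ⊨Γ σ (there σ∈Γ)))

true⇒Theorem-boolSubst : ∀ Ax v {φ} → evalB v φ ≡ true → Theorem Ax (φ [ boolSubst v ])
true⇒Theorem-boolSubst Ax v {φ} φ-true A _ h =
  FLwProperties.≤-reflexive A (sym (trans (⟦boolSubst⟧ A h v φ) (cong (FLwProperties.fromBool A) φ-true)))

passive⇒¬⋀-tautology : ∀ {Ax Γ} → Passive Ax Γ → ClassicalTautology (¬ᶠ ⋀ Γ)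
passive⇒¬⋀-tautology {Ax} {Γ} passive v with evalB v (⋀ Γ) in ⋀Γ-value
... | false = refl
... | true  = ⊥-elim (passive (boolSubst v , λ σ σ∈Γ →
                 true⇒Theorem-boolSubst Ax v {σ} (evalB-⋀ v ⋀Γ-value σ∈Γ)))

tautology⇒Theorem-¬∼ : ∀ {φ} → ClassicalTautology φ → Theorem GlivenkoAxiom (¬ᶠ ∼ᶠ φ)
tautology⇒Theorem-¬∼ {φ} taut A ⊨Ax = ⊨Ax (¬ᶠ ∼ᶠ φ) (φ , taut , refl)

theorem5p21 : (Ax : Axioms) → Extends Ax GlivenkoAxiom → PassivelyStructurallyComplete Ax
theorem5p21 Ax extends Γ γ passive _ A ⊨Ax h ⊨Γ =
  ≤-trans (one≤zero-from-¬∼¬ (one≤⟦⋀⟧ A h Γ ⊨Γ) (¬∼¬⋀Γ A ⊨Ax h)) (zero-least _)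
  where
  open FLwAlgebra A
  open FLwProperties A

  ¬∼¬⋀Γ : Theorem Ax (¬ᶠ ∼ᶠ ¬ᶠ ⋀ Γ)
  ¬∼¬⋀Γ = extends (¬ᶠ ∼ᶠ ¬ᶠ ⋀ Γ) (tautology⇒Theorem-¬∼ {¬ᶠ ⋀ Γ} (passive⇒¬⋀-tautology passive))
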